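{- Let $r,s\in\mathbb N$ with $r\ge 2s+1$, and let $a_1,\dots,a_{2s}\in[1,r-1]$ with $a_i<a_{i+1}$ for $i=1,\dots,2s-1$. Let $x_i=\sum_{j=1}^{i}a_{2j}-\sum_{j=0}^{i-1}a_{2j+1}$ for $i=1,\dots,s$, $y_1=r-a_1$, and $y_i=r+\sum_{j=1}^{i-1}a_{2j}-\sum_{j=0}^{i-1}a_{2j+1}$ for $i=2,\dots,s$. Let $G$ be a bipartite graph with vertex bipartition $\{A,B\}$ with $|A|=s+1$, $|B|=s$, and let $f\colon A\cup B\to[0,r-1]$ be a $\overline{\rho}$-labeling with $f(A)=\{0,x_1,\dots,x_s\}$ and $f(B)=\{y_1,\dots,y_s\}$. Then: (1) the $k$-shift $f_k$ is an $(A,B,r-1)$-uniformly ordered labeling of $G$ if and only if $k\in[0,a_1-1]$; (2) $f_k$ is $(B,A,r-1)$-uniformly ordered if and only if $k\in[r-y_s,\,r-1-x_s]$.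
   Context: $\mathbb N=\{0,1,2,\dots\}$; $[a,b]=\{x\in\mathbb N: a\le x\le b\}$. Graphs have no isolated vertices. For a graph $G=(V,E)$ with $|E|=m$ and $t\in\mathbb N$, a labeling is an injective map $f\colon V\to[0,t]$; it induces $\tilde f(\{u,v\})=|f(u)-f(v)|$. $f$ is a $\overline{\rho}$-labeling if (a) $t\ge 2m$, (b) $\tilde f$ is injective, (c) there is no $i\in\{1,\dots,m\}$ with both $i$ and $t+1-i$ in $\operatorname{Im}\tilde f$. For bipartite $G$ with vertex bipartition $\{A,B\}$, an $(A,B,t)$-uniformly ordered labeling is a $\overline{\rho}$-labeling $f\colon V\to[0,t]$ such that there is $\lambda\in\mathbb N$ with $f(a)\le\lambda$ for all $a\in A$ and $f(b)>\lambda$ for all $b\in B$; $(B,A,t)$-uniformly ordered is defined with $A,B$ exchanged. For $k\in[0,t]$, the $k$-shift of $f$ is $f_k(v)=f(v)+k$ reduced modulo $t+1$ into $[0,t]$. -}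

module Defs where

open import Data.Nat using (ℕ; zero; suc; _+_; _*_; _∸_; _≤_; _<_; ∣_-_∣)
open import Data.Nat.DivMod using (_%_)
open import Data.Integer as ℤ using (ℤ; +_)
open import Data.Fin using (Fin)
open import Data.Sum using (_⊎_; inj₁; inj₂)
open import Data.Product using (_×_; _,_; ∃-syntax)
open import Data.List using (List; length)
open import Data.List.Membership.Propositional using (_∈_)
open import Data.List.Relation.Unary.Unique.Propositional using (Unique)
open import Relation.Binary.PropositionalEquality using (_≡_)
open import Relation.Nullary using (¬_)

-- A finite simple bipartite graph with vertex bipartition {A,B},
-- A = Fin p (vertices inj₁ a), B = Fin q (vertices inj₂ b).
record BipGraph (p q : ℕ) : Set where
  field
    edges        : List (Fin p × Fin q)
    simple       : Unique edges
    noIsolatedA  : ∀ (a : Fin p) → ∃[ b ] ((a , b) ∈ edges)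
    noIsolatedB  : ∀ (b : Fin q) → ∃[ a ] ((a , b) ∈ edges)

open BipGraph public

Vertex : ℕ → ℕ → Set
Vertex p q = Fin p ⊎ Fin q

numEdges : ∀ {p q} → BipGraph p q → ℕ
numEdges G = length (edges G)

edgeLabel : ∀ {p q} → (Vertex p q → ℕ) → Fin p × Fin q → ℕ
edgeLabel f (a , b) = ∣ f (inj₁ a) - f (inj₂ b) ∣

InEdgeImage : ∀ {p q} → BipGraph p q → (Vertex p q → ℕ) → ℕ → Set
InEdgeImage G f i = ∃[ e ] (e ∈ edges G × edgeLabel f e ≡ i)

IsLabeling : ∀ {p q} → ℕ → (Vertex p q → ℕ) → Set
IsLabeling {p} {q} t f =
  (∀ (u v : Vertex p q) → f u ≡ f v → u ≡ v) × (∀ (v : Vertex p q) → f v ≤ t)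

IsRhoBar : ∀ {p q} → BipGraph p q → ℕ → (Vertex p q → ℕ) → Set
IsRhoBar G t f =
  IsLabeling t f
  × (2 * numEdges G ≤ t)
  × (∀ e e′ → e ∈ edges G → e′ ∈ edges G → edgeLabel f e ≡ edgeLabel f e′ → e ≡ e′)
  × (∀ i → 1 ≤ i → i ≤ numEdges G →
       ¬ (InEdgeImage G f i × InEdgeImage G f (t + 1 ∸ i)))

UniformlyOrderedAB : ∀ {p q} → BipGraph p q → ℕ → (Vertex p q → ℕ) → Set
UniformlyOrderedAB G t f =
  IsRhoBar G t f
  × ∃[ λ′ ] ((∀ a → f (inj₁ a) ≤ λ′) × (∀ b → λ′ < f (inj₂ b)))

UniformlyOrderedBA : ∀ {p q} → BipGraph p q → ℕ → (Vertex p q → ℕ) → Set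
UniformlyOrderedBA G t f =
  IsRhoBar G t f
  × ∃[ λ′ ] ((∀ b → f (inj₂ b) ≤ λ′) × (∀ a → λ′ < f (inj₁ a)))

shift : ∀ {p q} → ℕ → (Vertex p q → ℕ) → ℕ → Vertex p q → ℕ
shift t f k v = (f v + k) % suc t

sumℤ : (ℕ → ℤ) → ℕ → ℤ
sumℤ g zero    = + 0
sumℤ g (suc n) = sumℤ g n ℤ.+ g n

xSeq : (ℕ → ℕ) → ℕ → ℤ
xSeq a i = sumℤ (λ j → + a (2 * suc j)) i ℤ.- sumℤ (λ j → + a (2 * j + 1)) i

ySeq : ℕ → (ℕ → ℕ) → ℕ → ℤ
ySeq r a 1 = + r ℤ.- + a 1
ySeq r a i = (+ r ℤ.+ sumℤ (λ j → + a (2 * suc j)) (i ∸ 1))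
             ℤ.- sumℤ (λ j → + a (2 * j + 1)) i

{-# OPTIONS --safe #-}
module Submission where

-- The sequence x is nondecreasing, y is nonincreasing and y_s = x_s + (r - a_2s), so f puts A into
-- [0, x_s] and B into [y_s, y_1] with x_s < y_s and y_1 = r - a_1, all four endpoints attained.
-- A k-shift preserves every label difference inside a block that does not wrap around modulo r.
-- If nothing wraps (k ≤ a_1 - 1) the edge labels are unchanged and A stays below B; if exactly B
-- wraps (r - y_s ≤ k ≤ r - 1 - x_s) then B drops below A and every edge label i becomes r - i,
-- which preserves the ρ̄-conditions. For any other k, either the vertex labelled 0 (now k) and
-- the image of y_1 (first part) or of y_s (second part) are out of order, or x_s wraps and lands
-- above the image of y_s.

open import Defs
open import Data.Nat using (ℕ; zero; suc; _+_; _*_; _∸_; _≤_; _<_; _≤′_; ≤′-refl; ≤′-step; z≤n; s≤s; s≤s⁻¹; ∣_-_∣; NonZero)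
open import Data.Nat.Properties
open import Data.Nat.DivMod using (_%_; m%n<n; m<n⇒m%n≡m; m≤n⇒[n∸m]%m≡n%m; %-distribˡ-+; m%n%n≡m%n; [m+n]%n≡m%n)
import Data.Nat.Tactic.RingSolver as ℕ-Solver
open import Data.Integer as ℤ using (ℤ; +_; +≤+)
import Data.Integer.Properties as ℤ
import Data.Integer.Tactic.RingSolver as ℤ-Solver
open import Data.Fin as Fin using (Fin)
open import Data.Fin.Properties using (¬Fin0)
open import Data.Sum using (_⊎_; inj₁; inj₂)
open import Data.Product using (_×_; _,_; -,_; ∃-syntax; proj₁; proj₂)
open import Data.Product.Function.NonDependent.Propositional using (_×-⇔_)
open import Data.List.Membership.Propositional using (_∈_)
open import Function.Bundles using (_⇔_; mk⇔)
import Function.Properties.Equivalence as ⇔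
open import Relation.Binary.Core using (Rel)
open import Relation.Binary.Definitions using (Reflexive; Transitive)
open import Relation.Binary.PropositionalEquality
open import Relation.Nullary using (¬_; yes; no; contradiction)

%-wrap : ∀ {m n} .{{_ : NonZero n}} → n ≤ m → m < n + n → m % n + n ≡ m
%-wrap {m} {n} n≤m m<n+n = begin
  m % n + n       ≡⟨ cong (_+ n) (m≤n⇒[n∸m]%m≡n%m n≤m) ⟨
  (m ∸ n) % n + n ≡⟨ cong (_+ n) (m<n⇒m%n≡m (m<n+o⇒m∸n<o m n m<n+n)) ⟩
  m ∸ n + n       ≡⟨ m∸n+n≡m n≤m ⟩
  m               ∎
  where open ≡-Reasoning

[[m+k]%n+[n∸k]]%n≡m : ∀ {m k n} .{{_ : NonZero n}} → m < n → k ≤ n → ((m + k) % n + (n ∸ k)) % n ≡ m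
[[m+k]%n+[n∸k]]%n≡m {m} {k} {n} m<n k≤n = begin
  ((m + k) % n + (n ∸ k)) % n         ≡⟨ %-distribˡ-+ ((m + k) % n) (n ∸ k) n ⟩
  ((m + k) % n % n + (n ∸ k) % n) % n ≡⟨ cong (λ x → (x + (n ∸ k) % n) % n) (m%n%n≡m%n (m + k) n) ⟩
  ((m + k) % n + (n ∸ k) % n) % n     ≡⟨ %-distribˡ-+ (m + k) (n ∸ k) n ⟨
  (m + k + (n ∸ k)) % n               ≡⟨ cong (_% n) (trans (+-assoc m k (n ∸ k)) (cong (λ z → m + z) (m+[n∸m]≡n k≤n))) ⟩
  (m + n) % n                         ≡⟨ [m+n]%n≡m%n m n ⟩
  m % n                               ≡⟨ m<n⇒m%n≡m m<n ⟩
  m                                   ∎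
  where open ≡-Reasoning

∣x+k-w∣+∣x-y∣≡n : ∀ {x y k w n} → x ≤ y → w ≤ x + k → w + n ≡ y + k → ∣ x + k - w ∣ + ∣ x - y ∣ ≡ n
∣x+k-w∣+∣x-y∣≡n {x} {y} {k} {w} {n} x≤y w≤x+k w+n≡y+k = +-cancelˡ-≡ (w + x) _ _ (begin
  w + x + (∣ x + k - w ∣ + ∣ x - y ∣) ≡⟨ cong₂ (λ d e → w + x + (d + e)) (m≤n⇒∣n-m∣≡n∸m w≤x+k) (m≤n⇒∣m-n∣≡n∸m x≤y) ⟩
  w + x + ((x + k ∸ w) + (y ∸ x))     ≡⟨ interchange w x (x + k ∸ w) (y ∸ x) ⟩
  (w + (x + k ∸ w)) + (x + (y ∸ x))   ≡⟨ cong₂ _+_ (m+[n∸m]≡n w≤x+k) (m+[n∸m]≡n x≤y) ⟩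
  x + k + y                           ≡⟨ x+k+y≡x+[y+k] x k y ⟩
  x + (y + k)                         ≡⟨ cong (λ z → x + z) w+n≡y+k ⟨
  x + (w + n)                         ≡⟨ x+[w+n]≡w+x+n x w n ⟩
  w + x + n                           ∎)
  where
    open ≡-Reasoning
    open import Algebra.Properties.CommutativeSemigroup +-commutativeSemigroup using (interchange)
    x+k+y≡x+[y+k] : ∀ x k y → x + k + y ≡ x + (y + k)
    x+k+y≡x+[y+k] = ℕ-Solver.solve-∀
    x+[w+n]≡w+x+n : ∀ x w n → x + (w + n) ≡ w + x + n
    x+[w+n]≡w+x+n = ℕ-Solver.solve-∀

+≤+-⇔ : ∀ {m n} → m ≤ n ⇔ + m ℤ.≤ + n
+≤+-⇔ = mk⇔ +≤+ ℤ.drop‿+≤+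

+m-+n≡+[m∸n] : ∀ {m n} → n ≤ m → + m ℤ.- + n ≡ + (m ∸ n)
+m-+n≡+[m∸n] {m} {n} n≤m = trans (ℤ.m-n≡m⊖n m n) (ℤ.⊖-≥ n≤m)

+z≡+[1+t]-+m⇒t∸z≡m∸1 : ∀ {t m z} → + z ≡ + suc t ℤ.- + m → 1 ≤ m → m ≤ suc t → t ∸ z ≡ m ∸ 1
+z≡+[1+t]-+m⇒t∸z≡m∸1 {t} {suc m} z≡ _ m<1+t =
  trans (cong (t ∸_) (ℤ.+-injective (trans z≡ (+m-+n≡+[m∸n] m<1+t)))) (m∸[m∸n]≡n (s≤s⁻¹ m<1+t))

module _ {a ℓ} {A : Set a} {_≼_ : Rel A ℓ} (≼-refl : Reflexive _≼_) (≼-trans : Transitive _≼_)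
         (u : ℕ → A) {n : ℕ} (step : ∀ i → suc i ≤ n → u i ≼ u (suc i)) where

  stepwise-monotone : ∀ {i j} → i ≤ j → j ≤ n → u i ≼ u j
  stepwise-monotone i≤j = go (≤⇒≤′ i≤j)
    where
      go : ∀ {i j} → i ≤′ j → j ≤ n → u i ≼ u j
      go ≤′-refl        _   = ≼-refl
      go (≤′-step i≤′j) j<n = ≼-trans (go i≤′j (<⇒≤ j<n)) (step _ j<n)

module _ (a : ℕ → ℕ) where

  private
    evenSum oddSum : ℕ → ℤ
    evenSum = sumℤ (λ j → + a (2 * suc j))
    oddSum  = sumℤ (λ j → + a (2 * j + 1))

  xSeq-suc : ∀ i → xSeq a (suc i) ≡ xSeq a i ℤ.+ (+ a (2 * suc i) ℤ.- + a (2 * i + 1))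
  xSeq-suc i = [p+q]-[r+s]≡[p-r]+[q-s] (evenSum i) (+ a (2 * suc i)) (oddSum i) (+ a (2 * i + 1))
    where
      [p+q]-[r+s]≡[p-r]+[q-s] : ∀ p q r s → (p ℤ.+ q) ℤ.- (r ℤ.+ s) ≡ (p ℤ.- r) ℤ.+ (q ℤ.- s)
      [p+q]-[r+s]≡[p-r]+[q-s] = ℤ-Solver.solve-∀

  module _ (r : ℕ) where

    ySeq-suc-odd : ∀ i → ySeq r a (suc i) ≡ (+ r ℤ.+ xSeq a i) ℤ.- + a (2 * i + 1)
    ySeq-suc-odd zero    = cong (λ x → x ℤ.- + a 1) (sym (ℤ.+-identityʳ (+ r)))
    ySeq-suc-odd (suc i) = [p+q]-[r+s]≡[p+[q-r]]-s (+ r) (evenSum (suc i)) (oddSum (suc i)) (+ a (2 * suc i + 1))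
      where
        [p+q]-[r+s]≡[p+[q-r]]-s : ∀ p q r s → (p ℤ.+ q) ℤ.- (r ℤ.+ s) ≡ (p ℤ.+ (q ℤ.- r)) ℤ.- s
        [p+q]-[r+s]≡[p+[q-r]]-s = ℤ-Solver.solve-∀

    ySeq-suc-even : ∀ i → ySeq r a (suc i) ≡ (+ r ℤ.+ xSeq a (suc i)) ℤ.- + a (2 * suc i)
    ySeq-suc-even i = begin
      ySeq r a (suc i)                              ≡⟨ ySeq-suc-odd i ⟩
      (+ r ℤ.+ xSeq a i) ℤ.- o                      ≡⟨ [p+x]-o≡[p+[x+[e-o]]]-e (+ r) (xSeq a i) e o ⟩
      (+ r ℤ.+ (xSeq a i ℤ.+ (e ℤ.- o))) ℤ.- e      ≡⟨ cong (λ x → (+ r ℤ.+ x) ℤ.- e) (xSeq-suc i) ⟨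
      (+ r ℤ.+ xSeq a (suc i)) ℤ.- e                ∎
      where
        open ≡-Reasoning
        e = + a (2 * suc i)
        o = + a (2 * i + 1)
        [p+x]-o≡[p+[x+[e-o]]]-e : ∀ p x e o → (p ℤ.+ x) ℤ.- o ≡ (p ℤ.+ (x ℤ.+ (e ℤ.- o))) ℤ.- e
        [p+x]-o≡[p+[x+[e-o]]]-e = ℤ-Solver.solve-∀

  module _ {s : ℕ} (a-mono : ∀ i → 1 ≤ i → suc i ≤ 2 * s → a i ≤ a (suc i)) where

    private
      2[1+j]≡1+[2j+1] : ∀ j → 2 * suc j ≡ suc (2 * j + 1)
      2[1+j]≡1+[2j+1] = ℕ-Solver.solve-∀

      odd≤even : ∀ j → suc j ≤ s → a (2 * j + 1) ≤ a (2 * suc j)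
      odd≤even j j<s = subst (λ m → a (2 * j + 1) ≤ a m) (sym (2[1+j]≡1+[2j+1] j))
        (a-mono (2 * j + 1) (m≤n+m 1 _)
          (subst (_≤ 2 * s) (2[1+j]≡1+[2j+1] j) (*-monoʳ-≤ 2 j<s)))

      even≤odd : ∀ j → suc (suc j) ≤ s → a (2 * suc j) ≤ a (2 * suc j + 1)
      even≤odd j j+1<s = subst (λ m → a (2 * suc j) ≤ a m) (+-comm 1 _)
        (a-mono (2 * suc j) (s≤s z≤n)
          (≤-trans (s≤s (m≤m+n _ 1))
            (subst (_≤ 2 * s) (2[1+j]≡1+[2j+1] (suc j)) (*-monoʳ-≤ 2 j+1<s))))

    xSeq-monotone : ∀ {i j} → i ≤ j → j ≤ s → xSeq a i ℤ.≤ xSeq a j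
    xSeq-monotone i≤j = stepwise-monotone {_≼_ = ℤ._≤_} ℤ.≤-refl ℤ.≤-trans (xSeq a) step i≤j
      where
        step : ∀ j → suc j ≤ s → xSeq a j ℤ.≤ xSeq a (suc j)
        step j j<s = begin
          xSeq a j                                             ≤⟨ ℤ.i≤i+j (xSeq a j) (+ (e ∸ o)) ⟩
          xSeq a j ℤ.+ + (e ∸ o)                               ≡⟨ cong (λ d → xSeq a j ℤ.+ d) (+m-+n≡+[m∸n] (odd≤even j j<s)) ⟨
          xSeq a j ℤ.+ (+ e ℤ.- + o)                           ≡⟨ xSeq-suc j ⟨
          xSeq a (suc j)                                       ∎
          where
            open ℤ.≤-Reasoning
            e = a (2 * suc j)
            o = a (2 * j + 1)

    ySeq-antitone : ∀ r {i j} → 1 ≤ i → i ≤ j → j ≤ s → ySeq r a j ℤ.≤ ySeq r a i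
    ySeq-antitone r {suc i} {suc j} _ (s≤s i≤j) j<s =
      stepwise-monotone {_≼_ = ℤ._≥_} ℤ.≤-refl (λ p q → ℤ.≤-trans q p) (λ i → ySeq r a (suc i)) step i≤j ≤-refl
      where
        step : ∀ i → suc i ≤ j → ySeq r a (suc (suc i)) ℤ.≤ ySeq r a (suc i)
        step i i<j = begin
          ySeq r a (suc (suc i))                  ≡⟨ ySeq-suc-odd r (suc i) ⟩
          (+ r ℤ.+ xSeq a (suc i)) ℤ.- + o        ≤⟨ ℤ.+-monoʳ-≤ (+ r ℤ.+ xSeq a (suc i))
                                                       (ℤ.neg-mono-≤ (+≤+ (even≤odd i (≤-trans (s≤s i<j) j<s)))) ⟩
          (+ r ℤ.+ xSeq a (suc i)) ℤ.- + e        ≡⟨ ySeq-suc-even r i ⟨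
          ySeq r a (suc i)                        ∎
          where
            open ℤ.≤-Reasoning
            e = a (2 * suc i)
            o = a (2 * suc i + 1)

    xSeq-upperBound : ∀ {m X} → + X ≡ xSeq a s → m ≡ 0 ⊎ ∃[ i ] (1 ≤ i × i ≤ s × + m ≡ xSeq a i) → m ≤ X
    xSeq-upperBound _    (inj₁ refl)                 = z≤n
    xSeq-upperBound X≡xₛ (inj₂ (i , _ , i≤s , m≡xᵢ)) =
      ℤ.drop‿+≤+ (subst₂ ℤ._≤_ (sym m≡xᵢ) (sym X≡xₛ) (xSeq-monotone i≤s ≤-refl))

    ySeq-bounds : ∀ r {m Y Z} → + Y ≡ ySeq r a s → + Z ≡ ySeq r a 1 →
                  ∃[ i ] (1 ≤ i × i ≤ s × + m ≡ ySeq r a i) → Y ≤ m × m ≤ Z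
    ySeq-bounds r Y≡yₛ Z≡y₁ (i , 1≤i , i≤s , m≡yᵢ) =
      ℤ.drop‿+≤+ (subst₂ ℤ._≤_ (sym Y≡yₛ) (sym m≡yᵢ) (ySeq-antitone r 1≤i i≤s ≤-refl)) ,
      ℤ.drop‿+≤+ (subst₂ ℤ._≤_ (sym m≡yᵢ) (sym Z≡y₁) (ySeq-antitone r ≤-refl 1≤i i≤s))

  xSeq<ySeq : ∀ r n {X Y} → a (2 * suc n) < r → + X ≡ xSeq a (suc n) → + Y ≡ ySeq r a (suc n) → X < Y
  xSeq<ySeq r n {X} {Y} e<r X≡xₛ Y≡yₛ = subst (X <_) (sym Y≡X+[r∸e]) (m<m+n X (m<n⇒0<n∸m e<r))
    where
      e = a (2 * suc n)
      [p+x]-e≡x+[p-e] : ∀ p x e → (p ℤ.+ x) ℤ.- e ≡ x ℤ.+ (p ℤ.- e)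
      [p+x]-e≡x+[p-e] = ℤ-Solver.solve-∀
      Y≡X+[r∸e] : Y ≡ X + (r ∸ e)
      Y≡X+[r∸e] = ℤ.+-injective (begin
        + Y                                 ≡⟨ Y≡yₛ ⟩
        ySeq r a (suc n)                    ≡⟨ ySeq-suc-even r n ⟩
        (+ r ℤ.+ xSeq a (suc n)) ℤ.- + e    ≡⟨ [p+x]-e≡x+[p-e] (+ r) (xSeq a (suc n)) (+ e) ⟩
        xSeq a (suc n) ℤ.+ (+ r ℤ.- + e)    ≡⟨ cong₂ ℤ._+_ (sym X≡xₛ) (+m-+n≡+[m∸n] (<⇒≤ e<r)) ⟩
        + X ℤ.+ + (r ∸ e)                   ∎)
        where open ≡-Reasoning

module _ {p q : ℕ} (G : BipGraph p q) {t : ℕ} where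

  isRhoBar-transport : ∀ {f g} → IsRhoBar G t f → IsLabeling t g →
                       (∀ e → e ∈ edges G → edgeLabel g e ≡ edgeLabel f e) → IsRhoBar G t g
  isRhoBar-transport {f} {g} (_ , 2m≤t , f-inj , f-no-pair) g-labeling g≡f =
    g-labeling , 2m≤t , g-inj , g-no-pair
    where
      g-inj : ∀ e e′ → e ∈ edges G → e′ ∈ edges G → edgeLabel g e ≡ edgeLabel g e′ → e ≡ e′
      g-inj e e′ e∈ e′∈ eq = f-inj e e′ e∈ e′∈ (trans (sym (g≡f e e∈)) (trans eq (g≡f e′ e′∈)))
      image : ∀ {i} → InEdgeImage G g i → InEdgeImage G f i
      image (e , e∈ , refl) = e , e∈ , sym (g≡f e e∈)
      g-no-pair : ∀ i → 1 ≤ i → i ≤ numEdges G → ¬ (InEdgeImage G g i × InEdgeImage G g (t + 1 ∸ i))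
      g-no-pair i 1≤i i≤m (gᵢ , gⱼ) = f-no-pair i 1≤i i≤m (image gᵢ , image gⱼ)

  isRhoBar-transport-complement : ∀ {f g} → IsRhoBar G t f → IsLabeling t g →
                                  (∀ e → e ∈ edges G → edgeLabel g e + edgeLabel f e ≡ suc t) → IsRhoBar G t g
  -- i ↦ t + 1 - i maps each forbidden pair {i , t + 1 - i} onto itself.
  isRhoBar-transport-complement {f} {g} (_ , 2m≤t , f-inj , f-no-pair) g-labeling g+f≡N =
    g-labeling , 2m≤t , g-inj , g-no-pair
    where
      f≡N∸g : ∀ {e} → e ∈ edges G → edgeLabel f e ≡ suc t ∸ edgeLabel g e
      f≡N∸g {e} e∈ = trans (sym (m+n∸m≡n (edgeLabel g e) _)) (cong (_∸ edgeLabel g e) (g+f≡N e e∈))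
      g-inj : ∀ e e′ → e ∈ edges G → e′ ∈ edges G → edgeLabel g e ≡ edgeLabel g e′ → e ≡ e′
      g-inj e e′ e∈ e′∈ eq = f-inj e e′ e∈ e′∈ (trans (f≡N∸g e∈) (trans (cong (suc t ∸_) eq) (sym (f≡N∸g e′∈))))
      image : ∀ {i} → InEdgeImage G g i → InEdgeImage G f (suc t ∸ i)
      image (e , e∈ , refl) = e , e∈ , f≡N∸g e∈
      g-no-pair : ∀ i → 1 ≤ i → i ≤ numEdges G → ¬ (InEdgeImage G g i × InEdgeImage G g (t + 1 ∸ i))
      g-no-pair i 1≤i i≤m (gᵢ , gⱼ) = f-no-pair i 1≤i i≤m
        (subst (InEdgeImage G f) N∸[N∸i]≡i (image gⱼ) , subst (InEdgeImage G f) (cong (_∸ i) (+-comm 1 t)) (image gᵢ))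
        where
          N∸[N∸i]≡i : suc t ∸ (t + 1 ∸ i) ≡ i
          N∸[N∸i]≡i = trans (cong (λ N → suc t ∸ (N ∸ i)) (+-comm t 1))
                        (m∸[m∸n]≡n (m≤n⇒m≤1+n (≤-trans i≤m (≤-trans (m≤m+n _ _) 2m≤t))))

module _ {p q : ℕ} {t : ℕ} where

  shift-isLabeling : ∀ {f : Vertex p q → ℕ} {k} → IsLabeling t f → k ≤ t → IsLabeling t (shift t f k)
  shift-isLabeling {f} {k} (f-inj , f≤t) k≤t = g-inj , λ v → s≤s⁻¹ (m%n<n (f v + k) (suc t))
    where
      unshift : ∀ v → (shift t f k v + (suc t ∸ k)) % suc t ≡ f v
      unshift v = [[m+k]%n+[n∸k]]%n≡m (s≤s (f≤t v)) (m≤n⇒m≤1+n k≤t)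
      g-inj : ∀ u v → shift t f k u ≡ shift t f k v → u ≡ v
      g-inj u v eq = f-inj u v (trans (sym (unshift u)) (trans (cong (λ x → (x + (suc t ∸ k)) % suc t) eq) (unshift v)))

  module _ {f : Vertex p q → ℕ} (f≤t : ∀ v → f v ≤ t) {k : ℕ} (k≤t : k ≤ t) where

    shift-below : ∀ v → f v + k ≤ t → shift t f k v ≡ f v + k
    shift-below v fv+k≤t = m<n⇒m%n≡m (s≤s fv+k≤t)

    shift-zero : ∀ v → f v ≡ 0 → shift t f k v ≡ k
    shift-zero v fv≡0 = trans (shift-below v (subst (λ x → x + k ≤ t) (sym fv≡0) k≤t)) (cong (_+ k) fv≡0)

    shift-above : ∀ v → suc t ≤ f v + k → shift t f k v + suc t ≡ f v + k
    shift-above v N≤fv+k = %-wrap N≤fv+k (+-mono-<-≤ (s≤s (f≤t v)) (m≤n⇒m≤1+n k≤t))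

    shift-above<k : ∀ v → suc t ≤ f v + k → shift t f k v < k
    shift-above<k v N≤fv+k = +-cancelʳ-< (suc t) _ k (begin-strict
      shift t f k v + suc t ≡⟨ shift-above v N≤fv+k ⟩
      f v + k               ≤⟨ +-monoˡ-≤ k (f≤t v) ⟩
      t + k                 <⟨ +-monoˡ-< k (n<1+n t) ⟩
      suc t + k             ≡⟨ +-comm (suc t) k ⟩
      k + suc t             ∎)
      where open ≤-Reasoning

    f+k≤shift+N : ∀ v → f v + k ≤ shift t f k v + suc t
    f+k≤shift+N v with f v + k ≤? t
    ... | yes below = subst (_≤ shift t f k v + suc t) (shift-below v below) (m≤m+n _ _)
    ... | no  above = ≤-reflexive (sym (shift-above v (≰⇒> above)))

    shift-edgeLabel-below : (∀ v → f v + k ≤ t) → ∀ e → edgeLabel (shift t f k) e ≡ edgeLabel f e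
    shift-edgeLabel-below below (a , b) = begin
      ∣ shift t f k (inj₁ a) - shift t f k (inj₂ b) ∣ ≡⟨ cong₂ ∣_-_∣ (shifted (inj₁ a)) (shifted (inj₂ b)) ⟩
      ∣ k + f (inj₁ a) - k + f (inj₂ b) ∣             ≡⟨ ∣m+n-m+o∣≡∣n-o∣ k _ _ ⟩
      ∣ f (inj₁ a) - f (inj₂ b) ∣                     ∎
      where
        open ≡-Reasoning
        shifted : ∀ v → shift t f k v ≡ k + f v
        shifted v = trans (shift-below v (below v)) (+-comm (f v) k)

    shift-edgeLabel-complement : ∀ {a b} → f (inj₁ a) ≤ f (inj₂ b) → suc t ≤ f (inj₂ b) + k →
                                 f (inj₁ a) + k ≤ t → edgeLabel (shift t f k) (a , b) + edgeLabel f (a , b) ≡ suc t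
    shift-edgeLabel-complement {a} {b} fa≤fb b-above a-below =
      subst (λ x → ∣ x - shift t f k (inj₂ b) ∣ + edgeLabel f (a , b) ≡ suc t) (sym (shift-below (inj₁ a) a-below))
        (∣x+k-w∣+∣x-y∣≡n fa≤fb (≤-trans (<⇒≤ (shift-above<k (inj₂ b) b-above)) (m≤n+m k _)) (shift-above (inj₂ b) b-above))

module _ {p q : ℕ} (G : BipGraph p q) {t : ℕ} {f : Vertex p q → ℕ} (f≤t : ∀ v → f v ≤ t) {k : ℕ} (k≤t : k ≤ t) where

  shift-uniformlyOrderedAB : UniformlyOrderedAB G t f → (∀ v → f v + k ≤ t) → UniformlyOrderedAB G t (shift t f k)
  shift-uniformlyOrderedAB (ρ@(f-labeling , _) , λ′ , A≤λ′ , λ′<B) below =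
    isRhoBar-transport G ρ (shift-isLabeling f-labeling k≤t) (λ e _ → shift-edgeLabel-below f≤t k≤t below e) ,
    λ′ + k ,
    (λ a → subst (_≤ λ′ + k) (sym (shift-below f≤t k≤t (inj₁ a) (below (inj₁ a)))) (+-monoˡ-≤ k (A≤λ′ a))) ,
    (λ b → subst (λ′ + k <_) (sym (shift-below f≤t k≤t (inj₂ b) (below (inj₂ b)))) (+-monoˡ-< k (λ′<B b)))

  uniformlyOrderedAB-shift⇒below : ∀ {a₀} → f (inj₁ a₀) ≡ 0 → UniformlyOrderedAB G t (shift t f k) →
                                   ∀ b → f (inj₂ b) + k ≤ t
  uniformlyOrderedAB-shift⇒below {a₀} fa₀≡0 (_ , λ′ , A≤λ′ , λ′<B) b with f (inj₂ b) + k ≤? t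
  ... | yes below = below
  ... | no  above = contradiction (shift-above<k f≤t k≤t (inj₂ b) (≰⇒> above)) (<-asym k<g[b])
    where
      k<g[b] : k < shift t f k (inj₂ b)
      k<g[b] = ≤-<-trans (subst (_≤ λ′) (shift-zero f≤t k≤t (inj₁ a₀) fa₀≡0) (A≤λ′ a₀)) (λ′<B b)

  shift-uniformlyOrderedBA : UniformlyOrderedAB G t f → 0 < k →
                             (∀ a → f (inj₁ a) + k ≤ t) → (∀ b → suc t ≤ f (inj₂ b) + k) →
                             UniformlyOrderedBA G t (shift t f k)
  shift-uniformlyOrderedBA (ρ@(f-labeling , _) , λ′ , A≤λ′ , λ′<B) (s≤s {n = k′} _) A-below B-above =
    isRhoBar-transport-complement G ρ (shift-isLabeling f-labeling k≤t)
      (λ (a , b) _ → shift-edgeLabel-complement f≤t k≤t (<⇒≤ (≤-<-trans (A≤λ′ a) (λ′<B b))) (B-above b) (A-below a)) ,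
    k′ ,
    (λ b → s≤s⁻¹ (shift-above<k f≤t k≤t (inj₂ b) (B-above b))) ,
    (λ a → subst (k′ <_) (sym (shift-below f≤t k≤t (inj₁ a) (A-below a))) (m≤n+m k _))

  uniformlyOrderedBA-shift⇒above : ∀ {a₀} → f (inj₁ a₀) ≡ 0 → UniformlyOrderedBA G t (shift t f k) →
                                   ∀ b → suc t ≤ f (inj₂ b) + k
  uniformlyOrderedBA-shift⇒above {a₀} fa₀≡0 (_ , λ′ , B≤λ′ , λ′<A) b with f (inj₂ b) + k ≤? t
  ... | no  above = ≰⇒> above
  ... | yes below = contradiction (≤-<-trans (B≤λ′ b) (λ′<A a₀)) (≤⇒≯ g[a₀]≤g[b])
    where
      g[a₀]≤g[b] : shift t f k (inj₁ a₀) ≤ shift t f k (inj₂ b)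
      g[a₀]≤g[b] = subst₂ _≤_ (sym (shift-zero f≤t k≤t (inj₁ a₀) fa₀≡0)) (sym (shift-below f≤t k≤t (inj₂ b) below)) (m≤n+m k _)

  uniformlyOrderedBA-shift⇒B<above : UniformlyOrderedBA G t (shift t f k) →
                                     ∀ {a} → suc t ≤ f (inj₁ a) + k → ∀ b → f (inj₂ b) < f (inj₁ a)
  uniformlyOrderedBA-shift⇒B<above (_ , λ′ , B≤λ′ , λ′<A) {a} a-above b = +-cancelʳ-< k _ _ (begin-strict
    f (inj₂ b) + k                 ≤⟨ f+k≤shift+N f≤t k≤t (inj₂ b) ⟩
    shift t f k (inj₂ b) + suc t   <⟨ +-monoˡ-< (suc t) (≤-<-trans (B≤λ′ b) (λ′<A a)) ⟩
    shift t f k (inj₁ a) + suc t   ≡⟨ shift-above f≤t k≤t (inj₁ a) a-above ⟩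
    f (inj₁ a) + k                 ∎)
    where open ≤-Reasoning

record IntervalLabeling {p q : ℕ} (f : Vertex p q → ℕ) (X Y Z : ℕ) : Set where
  field
    X<Y : X < Y
    A≤X : ∀ a → f (inj₁ a) ≤ X
    Y≤B : ∀ b → Y ≤ f (inj₂ b)
    B≤Z : ∀ b → f (inj₂ b) ≤ Z
    0∈A : ∃[ a ] (f (inj₁ a) ≡ 0)
    X∈A : ∃[ a ] (f (inj₁ a) ≡ X)
    Y∈B : ∃[ b ] (f (inj₂ b) ≡ Y)
    Z∈B : ∃[ b ] (f (inj₂ b) ≡ Z)

module _ {p q : ℕ} (G : BipGraph p q) {t : ℕ} {f : Vertex p q → ℕ} {X Y Z : ℕ}
         (ρ : IsRhoBar G t f) (I : IntervalLabeling f X Y Z) where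

  open IntervalLabeling I

  private
    f≤t : ∀ v → f v ≤ t
    f≤t = proj₂ (proj₁ ρ)

    attained≤t : ∀ {m} → ∃[ v ] (f v ≡ m) → m ≤ t
    attained≤t (v , refl) = f≤t v

    f≤Z : ∀ v → f v ≤ Z
    f≤Z (inj₁ a) = ≤-trans (A≤X a) (≤-trans (<⇒≤ X<Y) (≤-trans (Y≤B b) (B≤Z b)))
      where b = proj₁ Y∈B
    f≤Z (inj₂ b) = B≤Z b

    f-uniformlyOrderedAB : UniformlyOrderedAB G t f
    f-uniformlyOrderedAB = ρ , X , A≤X , λ b → <-≤-trans X<Y (Y≤B b)

  shift-uniformlyOrderedAB⇔ : ∀ {k} → k ≤ t → UniformlyOrderedAB G t (shift t f k) ⇔ k ≤ t ∸ Z
  shift-uniformlyOrderedAB⇔ {k} k≤t = mk⇔ to from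
    where
      to : UniformlyOrderedAB G t (shift t f k) → k ≤ t ∸ Z
      to uo with Z∈B
      ... | b , refl = m+n≤o⇒m≤o∸n k (subst (_≤ t) (+-comm _ k)
                         (uniformlyOrderedAB-shift⇒below G f≤t k≤t (proj₂ 0∈A) uo b))
      from : k ≤ t ∸ Z → UniformlyOrderedAB G t (shift t f k)
      from k≤t∸Z = shift-uniformlyOrderedAB G f≤t k≤t f-uniformlyOrderedAB λ v →
        ≤-trans (+-monoˡ-≤ k (f≤Z v)) (subst (_≤ t) (+-comm k Z) (m≤o∸n⇒m+n≤o k (attained≤t (-, proj₂ Z∈B)) k≤t∸Z))

  shift-uniformlyOrderedBA⇔ : ∀ {k} → k ≤ t → UniformlyOrderedBA G t (shift t f k) ⇔ (suc t ∸ Y ≤ k × k ≤ t ∸ X)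
  shift-uniformlyOrderedBA⇔ {k} k≤t = mk⇔ to from
    where
      to : UniformlyOrderedBA G t (shift t f k) → suc t ∸ Y ≤ k × k ≤ t ∸ X
      to uo with Y∈B | X∈A
      ... | b , refl | a , refl =
        m≤n+o⇒m∸n≤o (suc t) _ (uniformlyOrderedBA-shift⇒above G f≤t k≤t (proj₂ 0∈A) uo b) ,
        m+n≤o⇒m≤o∸n k (subst (_≤ t) (+-comm _ k) a-below)
        where
          a-below : f (inj₁ a) + k ≤ t
          a-below with f (inj₁ a) + k ≤? t
          ... | yes below = below
          ... | no  above = contradiction (uniformlyOrderedBA-shift⇒B<above G f≤t k≤t uo (≰⇒> above) b) (<⇒≯ X<Y)
      from : suc t ∸ Y ≤ k × k ≤ t ∸ X → UniformlyOrderedBA G t (shift t f k)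
      from (N∸Y≤k , k≤t∸X) = shift-uniformlyOrderedBA G f≤t k≤t f-uniformlyOrderedAB 0<k A-below B-above
        where
          N≤Y+k : suc t ≤ Y + k
          N≤Y+k = ≤-trans (m≤n+m∸n (suc t) Y) (+-monoʳ-≤ Y N∸Y≤k)
          0<k : 0 < k
          0<k = +-cancelˡ-< Y 0 k (subst (_< Y + k) (sym (+-identityʳ Y)) (<-≤-trans (s≤s (attained≤t (-, proj₂ Y∈B))) N≤Y+k))
          A-below : ∀ a → f (inj₁ a) + k ≤ t
          A-below a = ≤-trans (+-monoˡ-≤ k (A≤X a)) (subst (_≤ t) (+-comm k X) (m≤o∸n⇒m+n≤o k (attained≤t (-, proj₂ X∈A)) k≤t∸X))
          B-above : ∀ b → suc t ≤ f (inj₂ b) + k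
          B-above b = ≤-trans N≤Y+k (+-monoˡ-≤ k (Y≤B b))

module _ {p q : ℕ} {f : Vertex p q → ℕ} {a : ℕ → ℕ} {r n : ℕ}
         (a-mono : ∀ i → 1 ≤ i → suc i ≤ 2 * suc n → a i ≤ a (suc i)) (a[2+2n]<r : a (2 * suc n) < r) where

  sequences-intervalLabeling :
    (∀ v → f (inj₁ v) ≡ 0 ⊎ ∃[ i ] (1 ≤ i × i ≤ suc n × + f (inj₁ v) ≡ xSeq a i)) →
    (∀ v → ∃[ i ] (1 ≤ i × i ≤ suc n × + f (inj₂ v) ≡ ySeq r a i)) →
    ∃[ v ] (f (inj₁ v) ≡ 0) →
    ∀ {vx vy vz} → + f (inj₁ vx) ≡ xSeq a (suc n) → + f (inj₂ vy) ≡ ySeq r a (suc n) → + f (inj₂ vz) ≡ ySeq r a 1 →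
    IntervalLabeling f (f (inj₁ vx)) (f (inj₂ vy)) (f (inj₂ vz))
  sequences-intervalLabeling A-labels B-labels 0∈A X≡xₛ Y≡yₛ Z≡y₁ = record
    { X<Y = xSeq<ySeq a r n a[2+2n]<r X≡xₛ Y≡yₛ
    ; A≤X = λ v → xSeq-upperBound a a-mono X≡xₛ (A-labels v)
    ; Y≤B = λ b → proj₁ (ySeq-bounds a a-mono r Y≡yₛ Z≡y₁ (B-labels b))
    ; B≤Z = λ b → proj₂ (ySeq-bounds a a-mono r Y≡yₛ Z≡y₁ (B-labels b))
    ; 0∈A = 0∈A
    ; X∈A = -, refl
    ; Y∈B = -, refl
    ; Z∈B = -, refl
    }

corollary4 : (r s : ℕ) → 2 * s + 1 ≤ r
  → (a : ℕ → ℕ)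
  → (∀ i → 1 ≤ i → i ≤ 2 * s → 1 ≤ a i × a i ≤ r ∸ 1)
  → (∀ i → 1 ≤ i → i ≤ 2 * s ∸ 1 → a i < a (suc i))
  → (G : BipGraph (suc s) s)
  → (f : Vertex (suc s) s → ℕ)
  → IsRhoBar G (r ∸ 1) f
  → (∀ (v : Fin (suc s)) → (f (inj₁ v) ≡ 0 ⊎ ∃[ i ] (1 ≤ i × i ≤ s × + f (inj₁ v) ≡ xSeq a i)))
  → (∃[ v ] (f (inj₁ v) ≡ 0))
  → (∀ i → 1 ≤ i → i ≤ s → ∃[ v ] (+ f (inj₁ v) ≡ xSeq a i))
  → (∀ (v : Fin s) → ∃[ i ] (1 ≤ i × i ≤ s × + f (inj₂ v) ≡ ySeq r a i))
  → (∀ i → 1 ≤ i → i ≤ s → ∃[ v ] (+ f (inj₂ v) ≡ ySeq r a i))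
  → ((k : ℕ) → k ≤ r ∸ 1 →
       (UniformlyOrderedAB G (r ∸ 1) (shift (r ∸ 1) f k) ⇔ k ≤ a 1 ∸ 1))
    × ((k : ℕ) → k ≤ r ∸ 1 →
       (UniformlyOrderedBA G (r ∸ 1) (shift (r ∸ 1) f k)
         ⇔ ((+ r ℤ.- ySeq r a s) ℤ.≤ + k × + k ℤ.≤ (+ r ℤ.- + 1 ℤ.- xSeq a s))))
corollary4 zero s 2s+1≤0 = contradiction (m+n≤o⇒n≤o (2 * s) 2s+1≤0) λ ()
corollary4 (suc t) zero _ _ _ _ G = contradiction (proj₁ (noIsolatedA G Fin.zero)) ¬Fin0
corollary4 (suc t) s@(suc n) _ a a-range a-increasing G f ρ A-labels 0∈A x-attained B-labels y-attained
  with x-attained s (s≤s z≤n) ≤-refl | y-attained s (s≤s z≤n) ≤-refl | y-attained 1 (s≤s z≤n) (s≤s z≤n)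
... | vx , X≡xₛ | vy , Y≡yₛ | vz , Z≡y₁ =
  (λ k k≤t → subst (λ m → UniformlyOrderedAB G t (shift t f k) ⇔ k ≤ m) t∸Z≡a₁∸1 (shift-uniformlyOrderedAB⇔ G ρ I k≤t)) ,
  (λ k k≤t → subst₂ (λ lo hi → UniformlyOrderedBA G t (shift t f k) ⇔ (lo ℤ.≤ + k × + k ℤ.≤ hi)) lo≡ hi≡
               (⇔.trans (shift-uniformlyOrderedBA⇔ G ρ I k≤t) (+≤+-⇔ ×-⇔ +≤+-⇔)))
  where
    f≤t : ∀ v → f v ≤ t
    f≤t = proj₂ (proj₁ ρ)
    a-mono : ∀ i → 1 ≤ i → suc i ≤ 2 * s → a i ≤ a (suc i)
    a-mono i 1≤i i<2s = <⇒≤ (a-increasing i 1≤i (s≤s⁻¹ i<2s))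
    I : IntervalLabeling f (f (inj₁ vx)) (f (inj₂ vy)) (f (inj₂ vz))
    I = sequences-intervalLabeling a-mono (s≤s (proj₂ (a-range (2 * s) (s≤s z≤n) ≤-refl))) A-labels B-labels 0∈A X≡xₛ Y≡yₛ Z≡y₁
    t∸Z≡a₁∸1 : t ∸ f (inj₂ vz) ≡ a 1 ∸ 1
    t∸Z≡a₁∸1 = let 1≤a₁ , a₁≤t = a-range 1 (s≤s z≤n) (s≤s z≤n) in +z≡+[1+t]-+m⇒t∸z≡m∸1 Z≡y₁ 1≤a₁ (m≤n⇒m≤1+n a₁≤t)
    lo≡ : + (suc t ∸ f (inj₂ vy)) ≡ + suc t ℤ.- ySeq (suc t) a s
    lo≡ = trans (sym (+m-+n≡+[m∸n] (m≤n⇒m≤1+n (f≤t _)))) (cong (λ y → + suc t ℤ.- y) Y≡yₛ)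
    hi≡ : + (t ∸ f (inj₁ vx)) ≡ + suc t ℤ.- + 1 ℤ.- xSeq a s
    hi≡ = trans (sym (+m-+n≡+[m∸n] (f≤t _))) (cong (λ x → + t ℤ.- x) X≡xₛ)
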